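{- Let $G$ and $H$ be connected graphs with $|V(G)|\ge 2$ and $|V(H)|\ge 3$, and let $c$ be an exact $r$-coloring of $G\square H$ with $r\ge 3$ such that no 3-AP is rainbow under $c$. If $w_iw_j\in E(H)$, then $|c(V(G_i)\cup V(G_j))|\le 2$.
   Context: All graphs are finite, simple and undirected; $\textup{d}(u,v)$ denotes shortest-path distance. The Cartesian product $G\square H$ has vertex set $V(G)\times V(H)$, with $(x,y)$ adjacent to $(x',y')$ iff either $x=x'$ and $yy'\in E(H)$, or $y=y'$ and $xx'\in E(G)$. Write $V(G)=\{u_1,\dots,u_{n_1}\}$, $V(H)=\{w_1,\dots,w_{n_2}\}$ and $v_{a,b}=(u_a,w_b)$. For $1\le i\le n_2$, $G_i$ is the copy of $G$ corresponding to $w_i$, the subgraph induced by $\{v_{1,i},\dots,v_{n_1,i}\}$. A 3-term arithmetic progression (3-AP) is a set of vertices $\{v_1,v_2,v_3\}$ (listed in some order) with $\textup{d}(v_1,v_2)=\textup{d}(v_2,v_3)$. An exact $r$-coloring is a surjective map $c:V\to\{1,\dots,r\}$; a set is rainbow under $c$ if its vertices receive pairwise distinct colors; $c(S)=\{c(s):s\in S\}$. -}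

module Defs where

open import Level using (0ℓ)
open import Data.Nat using (ℕ; zero; suc; _≤_)
open import Data.Fin using (Fin)
open import Data.Fin.Properties using (any?; _≟_)
open import Data.Fin.Subset using (Subset; inside; outside)
open import Data.Product using (_×_; _,_; ∃; ∃-syntax; Σ)
open import Data.Sum using (_⊎_; inj₁; inj₂)
open import Data.Bool using (Bool; true; false)
open import Data.Vec using (tabulate)
open import Relation.Nullary using (¬_; Dec; yes; no)
open import Relation.Nullary.Decidable using (_⊎-dec_; ⌊_⌋)
open import Relation.Binary.PropositionalEquality using (_≡_; _≢_; refl)
open import Function using (Surjective)

record Graph (V : Set) : Set₁ where
  field
    Adj    : V → V → Set
    sym    : ∀ {x y} → Adj x y → Adj y x
    irrefl : ∀ {x} → ¬ Adj x x
open Graph public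

data Walk {V : Set} (G : Graph V) : V → V → ℕ → Set where
  nil  : ∀ {u} → Walk G u u 0
  cons : ∀ {u w v k} → Adj G u w → Walk G w v k → Walk G u v (suc k)

Dist : {V : Set} → Graph V → V → V → ℕ → Set
Dist G u v d = Walk G u v d × (∀ k → Walk G u v k → d ≤ k)

Connected : {V : Set} → Graph V → Set
Connected G = ∀ u v → ∃[ k ] Walk G u v k

_□_ : {V W : Set} → Graph V → Graph W → Graph (V × W)
_□_ {V} {W} G H = record { Adj = A ; sym = s ; irrefl = ir }
  where
    A : V × W → V × W → Set
    A (x , y) (x' , y') = (x ≡ x' × Adj H y y') ⊎ (y ≡ y' × Adj G x x')
    s : ∀ {p q} → A p q → A q p
    s (inj₁ (refl , a)) = inj₁ (refl , sym H a)
    s (inj₂ (refl , a)) = inj₂ (refl , sym G a)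
    ir : ∀ {p} → ¬ A p p
    ir (inj₁ (_ , a)) = irrefl H a
    ir (inj₂ (_ , a)) = irrefl G a

ExactColoring : {V : Set} → (r : ℕ) → (V → Fin r) → Set
ExactColoring r c = Surjective _≡_ _≡_ c

Rainbow3 : {V : Set} {r : ℕ} → (V → Fin r) → V → V → V → Set
Rainbow3 c x y z = c x ≢ c y × c y ≢ c z × c x ≢ c z

-- {v1,v2,v3} is a 3-AP (listed so that d(v1,v2) = d(v2,v3))
ThreeAP : {V : Set} → Graph V → V → V → V → Set
ThreeAP G v₁ v₂ v₃ = ∃[ d ] (Dist G v₁ v₂ d × Dist G v₂ v₃ d)

NoRainbow3AP : {V : Set} {r : ℕ} → Graph V → (V → Fin r) → Set
NoRainbow3AP G c = ∀ v₁ v₂ v₃ → ThreeAP G v₁ v₂ v₃ → ¬ Rainbow3 c v₁ v₂ v₃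

colorsOfLayers : {n₁ n₂ r : ℕ} → (Fin n₁ × Fin n₂ → Fin r) → Fin n₂ → Fin n₂ → Subset r
colorsOfLayers {n₁} c i j = tabulate λ k →
  side ⌊ any? (λ a → (c (a , i) ≟ k) ⊎-dec (c (a , j) ≟ k)) ⌋
  where
    side : Bool → _
    side true = inside
    side false = outside

-- Call (e , s), (a , s), (a , t) with s ~ t an L, rainbow if its colours γ, α, β differ.
-- In a shortest rainbow L every inner vertex of an e–a geodesic has colour α in both layers:
-- any other colour closes a rainbow 3-AP or a shorter rainbow L. A layer k ~ s or k ~ t outside
-- {s , t} then closes a rainbow 3-AP through (e , k) or (a , k), so no L is rainbow. Three colours
-- on G_i ∪ G_j now give a rainbow L unless G_i and G_j are coloured alike; then G_i has an edge xy
-- with c x ≠ c y and a vertex e of the third colour, and as d(e,x), d(e,y) differ by at most one,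
-- (e , i) is the centre of a rainbow 3-AP ending at x and y, each taken in G_i or G_j.
module Submission where

open import Defs hiding (sym)
open import Data.Empty using (⊥; ⊥-elim)
open import Data.Fin using (Fin; zero; suc)
open import Data.Fin.Properties using (_≟_; any?; all?; ¬∀⟶∃¬; suc-injective)
open import Data.Fin.Subset using (Subset; ∣_∣; _∈_; inside; outside)
open import Data.Nat using (ℕ; zero; suc; _+_; _≤_; _<_; z≤n; s≤s; _≤?_)
open import Data.Nat.Induction using (<-rec)
open import Data.Nat.Properties
  using (≤-antisym; ≤-pred; ≰⇒>; <-cmp; +-suc; +-comm; +-mono-≤; +-cancelˡ-≤; +-cancelʳ-≤; m<m+n; m<n+m)
open import Data.Product using (_×_; _,_; proj₁; proj₂; ∃-syntax)
open import Data.Sum using (_⊎_; inj₁; inj₂)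
open import Data.Vec using (_∷_)
open import Data.Vec.Base using (here; there)
open import Data.Vec.Properties using ([]=⇒lookup; lookup∘tabulate)
open import Function using (_∘_)
open import Relation.Binary using (tri<; tri≈; tri>)
open import Relation.Binary.PropositionalEquality using (_≡_; _≢_; refl; sym; trans; cong; subst; ≢-sym)
open import Relation.Nullary using (¬_; Dec; yes; no)
open import Relation.Nullary.Decidable using (_⊎-dec_; decidable-stable)

≡-by-cases : ∀ {n} {x κ ν : Fin n} → (x ≢ κ → x ≡ ν → ⊥) → (x ≢ κ → x ≢ ν → ⊥) → x ≡ κ
≡-by-cases {x = x} {κ} {ν} when-ν otherwise with x ≟ κ | x ≟ ν
... | yes x≡κ | _       = x≡κ
... | no  x≢κ | yes x≡ν = ⊥-elim (when-ν x≢κ x≡ν)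
... | no  x≢κ | no  x≢ν = ⊥-elim (otherwise x≢κ x≢ν)

rainbow-escapes : ∀ {A : Set} {r} {f : A → Fin r} (S : A → Set) {x y z : A} →
                  S x → S y → S z → Rainbow3 f x y z →
                  ∀ κ ν → ∃[ v ] (S v × f v ≢ κ × f v ≢ ν)
rainbow-escapes {f = f} S {x} {y} {z} Sx Sy Sz (x≢y , y≢z , x≢z) κ ν
  with f x ≟ κ | f x ≟ ν
... | no x≢κ | no x≢ν = x , Sx , x≢κ , x≢ν
... | yes x≡κ | _ with f y ≟ ν
...   | no y≢ν  = y , Sy , (λ y≡κ → x≢y (trans x≡κ (sym y≡κ))) , y≢ν
...   | yes y≡ν = z , Sz , (λ z≡κ → x≢z (trans x≡κ (sym z≡κ))) , (λ z≡ν → y≢z (trans y≡ν (sym z≡ν)))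
rainbow-escapes {f = f} S {x} {y} {z} Sx Sy Sz (x≢y , y≢z , x≢z) κ ν
  | no _ | yes x≡ν with f y ≟ κ
...   | no y≢κ  = y , Sy , y≢κ , (λ y≡ν → x≢y (trans x≡ν (sym y≡ν)))
...   | yes y≡κ = z , Sz , (λ z≡κ → y≢z (trans y≡κ (sym z≡κ))) , (λ z≡ν → x≢z (trans x≡ν (sym z≡ν)))

module _ {V : Set} {G : Graph V} where

  infixr 5 _++ᵂ_

  _++ᵂ_ : ∀ {u v w m n} → Walk G u v m → Walk G v w n → Walk G u w (m + n)
  nil      ++ᵂ q = q
  cons a p ++ᵂ q = cons a (p ++ᵂ q)

  snocᵂ : ∀ {u v w m} → Walk G u v m → Adj G v w → Walk G u w (suc m)
  snocᵂ nil        a = cons a nil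
  snocᵂ (cons b p) a = cons b (snocᵂ p a)

  reverseᵂ : ∀ {u v m} → Walk G u v m → Walk G v u m
  reverseᵂ nil        = nil
  reverseᵂ (cons a p) = snocᵂ (reverseᵂ p) (Graph.sym G a)

  unsnocᵂ : ∀ {u v m} → Walk G u v (suc m) → ∃[ x ] (Walk G u x m × Adj G x v)
  unsnocᵂ (cons a nil)        = _ , nil , a
  unsnocᵂ (cons a (cons b p)) with unsnocᵂ (cons b p)
  ... | x , q , x~v = x , cons a q , x~v

  walk-zero⇒≡ : ∀ {u v} → Walk G u v 0 → u ≡ v
  walk-zero⇒≡ nil = refl

  walk-exits : ∀ {S : V → Set} → (∀ x → Dec (S x)) → ∀ {u v n} → Walk G u v n → S u → ¬ S v →
               ∃[ x ] ∃[ y ] (Adj G x y × S x × ¬ S y)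
  walk-exits S? nil        Su ¬Sv = ⊥-elim (¬Sv Su)
  walk-exits S? (cons {w = w} a p) Su ¬Sv with S? w
  ... | yes Sw = walk-exits S? p Sw ¬Sv
  ... | no ¬Sw = _ , w , a , Su , ¬Sw

  dist-refl : ∀ {u} → Dist G u u 0
  dist-refl = nil , λ _ _ → z≤n

  dist-sym : ∀ {u v d} → Dist G u v d → Dist G v u d
  dist-sym (p , shortest) = reverseᵂ p , λ k q → shortest k (reverseᵂ q)

  dist-zero⇒≡ : ∀ {u v} → Dist G u v 0 → u ≡ v
  dist-zero⇒≡ (p , _) = walk-zero⇒≡ p

  adj⇒dist-one : ∀ {u v} → Adj G u v → Dist G u v 1
  adj⇒dist-one {u} {v} a = cons a nil , shortest
    where
    shortest : ∀ k → Walk G u v k → 1 ≤ k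
    shortest zero    p with walk-zero⇒≡ p
    ... | refl = ⊥-elim (irrefl G a)
    shortest (suc k) _ = s≤s z≤n

  dist-two : ∀ {u v w} → Adj G u v → Adj G v w → u ≢ w → ¬ Adj G u w → Dist G u w 2
  dist-two {u} {v} {w} uv vw u≢w ¬uw = cons uv (cons vw nil) , shortest
    where
    shortest : ∀ k → Walk G u w k → 2 ≤ k
    shortest zero          p          = ⊥-elim (u≢w (walk-zero⇒≡ p))
    shortest (suc zero)    (cons a p) with walk-zero⇒≡ p
    ... | refl = ⊥-elim (¬uw a)
    shortest (suc (suc k)) _          = s≤s (s≤s z≤n)

  dist-split : ∀ {u v w m n} → Dist G u w (m + n) → Walk G u v m → Walk G v w n →
               Dist G u v m × Dist G v w n
  dist-split {m = m} {n} (_ , shortest) p q =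
    (p , λ k p′ → +-cancelʳ-≤ n m k (shortest (k + n) (p′ ++ᵂ q))) ,
    (q , λ k q′ → +-cancelˡ-≤ m n k (shortest (m + k) (p ++ᵂ q′)))

  dist-next : ∀ {u v d} → Dist G u v (suc d) → ∃[ w ] (Adj G u w × Dist G w v d)
  dist-next (cons a p , shortest) = _ , a , p , λ k q → ≤-pred (shortest (suc k) (cons a q))

  dist-neighbour-≤ : ∀ {u x y dx dy} → Dist G u x dx → Dist G u y dy → Adj G x y → dy ≤ suc dx
  dist-neighbour-≤ (p , _) (_ , shortest) a = shortest _ (snocᵂ p a)

  -- The least length of a walk exists only classically, which suffices as every goal below is ⊥.
  dist-exists : ∀ {u v n} → Walk G u v n → ¬ ¬ (∃[ d ] Dist G u v d)
  dist-exists {u} {v} {n} = <-rec (λ n → Walk G u v n → ¬ ¬ (∃[ d ] Dist G u v d)) step n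
    where
    step : ∀ n → (∀ {m} → m < n → Walk G u v m → ¬ ¬ (∃[ d ] Dist G u v d)) →
           Walk G u v n → ¬ ¬ (∃[ d ] Dist G u v d)
    step n shorter p none = none (n , p , shortest)
      where
      shortest : ∀ k → Walk G u v k → n ≤ k
      shortest k q with n ≤? k
      ... | yes n≤k = n≤k
      ... | no  n≰k = ⊥-elim (shorter (≰⇒> n≰k) q none)

  record GeodesicEnds (u v : V) (n : ℕ) : Set where
    field
      u₁ v₁ : V
      u-u₁  : Dist G u u₁ 1
      u₁-v  : Dist G u₁ v (suc n)
      u-v₁  : Dist G u v₁ (suc n)
      u₁-v₁ : Dist G u₁ v₁ n
      v₁-v  : Dist G v₁ v 1

  geodesic-ends : ∀ {u v n} → Dist G u v (suc (suc n)) → GeodesicEnds u v n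
  geodesic-ends {u} {v} {n} u-v with dist-next u-v
  ... | u₁ , u~u₁ , u₁-v with unsnocᵂ (proj₁ u₁-v)
  ...   | v₁ , p , v₁~v = record
    { u₁ = u₁ ; v₁ = v₁ ; u-u₁ = adj⇒dist-one u~u₁ ; u₁-v = u₁-v
    ; u-v₁ = proj₁ u-v₁-v ; u₁-v₁ = proj₂ (dist-split (proj₁ u-v₁-v) (cons u~u₁ nil) p)
    ; v₁-v = proj₂ u-v₁-v }
    where
    u-v₁-v : Dist G u v₁ (suc n) × Dist G v₁ v 1
    u-v₁-v = dist-split (subst (Dist G u v) (cong suc (+-comm 1 n)) u-v) (cons u~u₁ p) (cons v₁~v nil)

module _ {V W : Set} {G : Graph V} {H : Graph W} where

  walk-□ᴳ : ∀ {x y s k} → Walk G x y k → Walk (G □ H) (x , s) (y , s) k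
  walk-□ᴳ nil        = nil
  walk-□ᴳ (cons a p) = cons (inj₂ (refl , a)) (walk-□ᴳ p)

  walk-□ᴴ : ∀ {x s t k} → Walk H s t k → Walk (G □ H) (x , s) (x , t) k
  walk-□ᴴ nil        = nil
  walk-□ᴴ (cons a p) = cons (inj₁ (refl , a)) (walk-□ᴴ p)

  walk-□-project : ∀ {x y s t k} → Walk (G □ H) (x , s) (y , t) k →
                   ∃[ kᴳ ] ∃[ kᴴ ] (Walk G x y kᴳ × Walk H s t kᴴ × kᴴ + kᴳ ≡ k)
  walk-□-project nil = 0 , 0 , nil , nil , refl
  walk-□-project (cons (inj₁ (refl , a)) p) with walk-□-project p
  ... | kᴳ , kᴴ , pᴳ , pᴴ , eq = kᴳ , suc kᴴ , pᴳ , cons a pᴴ , cong suc eq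
  walk-□-project (cons (inj₂ (refl , a)) p) with walk-□-project p
  ... | kᴳ , kᴴ , pᴳ , pᴴ , eq = suc kᴳ , kᴴ , cons a pᴳ , pᴴ , trans (+-suc kᴴ kᴳ) (cong suc eq)

  dist-□ : ∀ {x y s t n g} → Dist H s t n → Dist G x y g → Dist (G □ H) (x , s) (y , t) (n + g)
  dist-□ (pᴴ , shortestᴴ) (pᴳ , shortestᴳ) = walk-□ᴴ pᴴ ++ᵂ walk-□ᴳ pᴳ , shortest
    where
    shortest : ∀ k → Walk (G □ H) _ _ k → _ ≤ k
    shortest k q with walk-□-project q
    ... | kᴳ , kᴴ , qᴳ , qᴴ , refl = +-mono-≤ (shortestᴴ kᴴ qᴴ) (shortestᴳ kᴳ qᴳ)

OnLayers : {V W : Set} → W → W → V × W → Set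
OnLayers i j (_ , l) = l ≡ i ⊎ l ≡ j

module NoRainbow {V W : Set} (G : Graph V) (H : Graph W) {r : ℕ}
                 (c : V × W → Fin r) (no-rainbow : NoRainbow3AP (G □ H) c) where

  fork : ∀ {v x y d} → Dist (G □ H) v x d → Dist (G □ H) v y d → ¬ Rainbow3 c x v y
  fork v-x v-y = no-rainbow _ _ _ (_ , dist-sym v-x , v-y)

  rainbow : ∀ {x y z κ₁ κ₂ κ₃} → c x ≡ κ₁ → c y ≡ κ₂ → c z ≡ κ₃ →
            κ₁ ≢ κ₂ → κ₂ ≢ κ₃ → κ₁ ≢ κ₃ → Rainbow3 c x y z
  rainbow refl refl refl κ₁≢κ₂ κ₂≢κ₃ κ₁≢κ₃ = κ₁≢κ₂ , κ₂≢κ₃ , κ₁≢κ₃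

  within : ∀ {x y s g} → Dist G x y g → Dist (G □ H) (x , s) (y , s) g
  within = dist-□ dist-refl

  across : ∀ {x y s t g} → Adj H s t → Dist G x y g → Dist (G □ H) (x , s) (y , t) (suc g)
  across st = dist-□ (adj⇒dist-one st)

  LRainbow : W → W → V → V → Set
  LRainbow s t e a = Rainbow3 c (e , s) (a , s) (a , t)

  LRainbowFreeAt : W → W → ℕ → Set
  LRainbowFreeAt s t m = ∀ {e a} → Dist G e a m → ¬ LRainbow s t e a

  LRainbowFree : W → W → Set
  LRainbowFree s t = ∀ e a → ¬ LRainbow s t e a

  L-rainbow-free-≤1 : ∀ {s t m} → Adj H s t → m ≤ 1 → LRainbowFreeAt s t m
  L-rainbow-free-≤1 st z≤n       e-a (γ≢α , _) = γ≢α (cong (λ x → c (x , _)) (dist-zero⇒≡ e-a))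
  L-rainbow-free-≤1 st (s≤s z≤n) e-a L         = fork (within (dist-sym e-a)) (across st dist-refl) L

  module ShortestLRainbow {s t} (st : Adj H s t) {n} (smaller : ∀ {m} → m < suc (suc n) → LRainbowFreeAt s t m)
                          {e a} (e-a : Dist G e a (suc (suc n))) (L : LRainbow s t e a) where

    α β γ : Fin r
    α = c (a , s)
    β = c (a , t)
    γ = c (e , s)

    γ≢α : γ ≢ α
    γ≢α = proj₁ L

    α≢β : α ≢ β
    α≢β = proj₁ (proj₂ L)

    γ≢β : γ ≢ β
    γ≢β = proj₂ (proj₂ L)

    ts : Adj H t s
    ts = Graph.sym H st

    inner-step : ∀ {x y i j} → suc i + suc j ≡ suc (suc n) →
                 Dist G e x (suc i) → Dist G x a (suc j) → Dist G e y (suc (suc i)) → Dist G y a j →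
                 c (y , s) ≡ α → c (x , s) ≡ α × c (x , t) ≡ α
    inner-step {x = x} {i = i} {j = j} lengths e-x x-a e-y y-a yˢ = xˢ , xᵗ
      where
      xᵗ : c (x , t) ≡ α
      xᵗ = ≡-by-cases
        (λ x≢α x≡γ → fork (within (dist-sym x-a)) (across ts (dist-sym y-a))
                          (rainbow x≡γ refl yˢ γ≢β (≢-sym α≢β) γ≢α))
        (λ x≢α x≢γ → fork (across st e-x) (within e-y) (rainbow refl refl yˢ x≢γ γ≢α x≢α))

      xˢ : c (x , s) ≡ α
      xˢ = ≡-by-cases
        (λ x≢α x≡β → smaller (subst (suc i <_) lengths (m<m+n (suc i) (s≤s z≤n))) e-x
                       (rainbow refl x≡β xᵗ γ≢β (≢-sym α≢β) γ≢α))
        (λ x≢α x≢β → smaller (subst (suc j <_) lengths (m<n+m (suc j) (s≤s z≤n))) x-a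
                       (x≢α , α≢β , x≢β))

    inner : ∀ j {x} i → suc i + suc j ≡ suc (suc n) → Dist G e x (suc i) → Dist G x a (suc j) →
            c (x , s) ≡ α × c (x , t) ≡ α
    inner zero    i lengths e-x x-a =
      inner-step lengths e-x x-a (subst (Dist G e a) (sym (trans (+-comm 1 (suc i)) lengths)) e-a) dist-refl refl
    inner (suc j) i lengths e-x x-a with dist-next x-a
    ... | y , x~y , y-a = inner-step lengths e-x x-a e-y y-a (proj₁ (inner j (suc i) lengths′ e-y y-a))
      where
      lengths′ : suc (suc i) + suc j ≡ suc (suc n)
      lengths′ = trans (cong suc (sym (+-suc i (suc j)))) lengths
      e-y : Dist G e y (suc (suc i))
      e-y = proj₁ (dist-split (subst (Dist G e a) (sym lengths′) e-a) (snocᵂ (proj₁ e-x) x~y) (proj₁ y-a))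

    open GeodesicEnds (geodesic-ends e-a) public
      renaming (u₁ to e₁; v₁ to a₁; u-u₁ to e-e₁; u₁-v to e₁-a; u-v₁ to e-a₁; u₁-v₁ to e₁-a₁; v₁-v to a₁-a)

    e₁ᵗ : c (e₁ , t) ≡ α
    e₁ᵗ = proj₂ (inner n 0 refl e-e₁ e₁-a)

    e₁ˢ : c (e₁ , s) ≡ α
    e₁ˢ = proj₁ (inner n 0 refl e-e₁ e₁-a)

    a₁ˢ : c (a₁ , s) ≡ α
    a₁ˢ = proj₁ (inner 0 n (+-comm (suc n) 1) e-a₁ a₁-a)

    a₁ᵗ : c (a₁ , t) ≡ α
    a₁ᵗ = proj₂ (inner 0 n (+-comm (suc n) 1) e-a₁ a₁-a)

    aᵏ : ∀ {k} → Adj H s k → c (a , k) ≡ β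
    aᵏ sk = ≡-by-cases
      (λ _ a≡γ → fork (across st dist-refl) (across sk dist-refl)
                      (rainbow refl refl a≡γ (≢-sym α≢β) (≢-sym γ≢α) (≢-sym γ≢β)))
      (λ a≢β a≢γ → fork (across st e-a) (across sk e-a) (≢-sym γ≢β , ≢-sym a≢γ , ≢-sym a≢β))

  L-rainbow-free-far : ∀ {s t k} → Adj H s t → Adj H t k → k ≢ s → ∀ m → LRainbowFreeAt s t m
  L-rainbow-free-far {s} {t} {k} st tk k≢s = <-rec (LRainbowFreeAt s t) step
    where
    step : ∀ m → (∀ {m′} → m′ < m → LRainbowFreeAt s t m′) → LRainbowFreeAt s t m
    step zero          _       = L-rainbow-free-≤1 st z≤n
    step (suc zero)    _       = L-rainbow-free-≤1 st (s≤s z≤n)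
    -- Adjacency in H is not decidable, so both alternatives are refuted.
    step (suc (suc n)) smaller {e} {a} e-a L = refute-s≁k refute-s~k
      where
      open ShortestLRainbow st smaller e-a L

      ks : Adj H k t
      ks = Graph.sym H tk

      eᵏ≢β : c (e , k) ≢ β
      eᵏ≢β e≡β with c (e , t) ≟ γ | c (e , t) ≟ α
      ... | yes e≡γ | _       = fork (within e-e₁) (across tk dist-refl)
                                  (rainbow e₁ᵗ e≡γ e≡β (≢-sym γ≢α) γ≢β α≢β)
      ... | no _    | yes e≡α = fork (across ts dist-refl) (across tk dist-refl)
                                  (rainbow refl e≡α e≡β γ≢α α≢β γ≢β)
      ... | no e≢γ  | no e≢α  = fork (across ts dist-refl) (within e-e₁)
                                  (rainbow refl refl e₁ᵗ (≢-sym e≢γ) e≢α γ≢α)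

      eᵏ : c (e , k) ≡ γ
      eᵏ = ≡-by-cases
        (λ _ e≡β → eᵏ≢β e≡β)
        (λ e≢γ e≢β → fork (across ts (dist-sym e-a)) (across tk (dist-sym e-a))
                          (γ≢β , ≢-sym e≢β , ≢-sym e≢γ))

      refute-s~k : ¬ Adj H s k
      refute-s~k sk = fork (within (dist-sym e-a)) (across ks (dist-sym e₁-a))
                    (rainbow eᵏ (aᵏ sk) e₁ᵗ γ≢β (≢-sym α≢β) γ≢α)

      refute-s≁k : ¬ ¬ Adj H s k
      refute-s≁k ¬sk = fork (within (dist-sym e-a₁)) (across ks (dist-sym e₁-a₁))
                     (rainbow eᵏ a₁ᵏ e₁ᵗ γ≢β (≢-sym α≢β) γ≢α)
        where
        a₁ᵏ : c (a₁ , k) ≡ β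
        a₁ᵏ = ≡-by-cases
          (λ _ a₁≡γ → fork (within a₁-a) (across tk dist-refl)
                           (rainbow refl a₁ᵗ a₁≡γ (≢-sym α≢β) (≢-sym γ≢α) (≢-sym γ≢β)))
          (λ a₁≢β a₁≢γ → fork (across st e-a) (dist-□ (dist-two st tk (≢-sym k≢s) ¬sk) e-a₁)
                              (≢-sym γ≢β , ≢-sym a₁≢γ , ≢-sym a₁≢β))

  L-rainbow-free-near : ∀ {s t k} → Adj H s t → Adj H s k → k ≢ t → ∀ m → LRainbowFreeAt s t m
  L-rainbow-free-near {s} {t} {k} st sk k≢t = <-rec (LRainbowFreeAt s t) step
    where
    step : ∀ m → (∀ {m′} → m′ < m → LRainbowFreeAt s t m′) → LRainbowFreeAt s t m
    step zero          _       = L-rainbow-free-≤1 st z≤n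
    step (suc zero)    _       = L-rainbow-free-≤1 st (s≤s z≤n)
    step (suc (suc n)) smaller {e} {a} e-a L = refute-t≁k refute-t~k
      where
      open ShortestLRainbow st smaller e-a L

      refute-t~k : ¬ Adj H t k
      refute-t~k tk with c (e , k) ≟ γ | c (e , k) ≟ β
      ... | yes e≡γ | _       = fork (within e-a) (across (Graph.sym H sk) e-a₁)
                                  (rainbow (aᵏ sk) e≡γ a₁ˢ (≢-sym γ≢β) γ≢α (≢-sym α≢β))
      ... | no _    | yes e≡β = fork (within e-e₁) (across sk dist-refl)
                                  (rainbow e₁ˢ refl e≡β (≢-sym γ≢α) γ≢β α≢β)
      ... | no e≢γ  | no e≢β  = fork (across ts (dist-sym e-a)) (across tk (dist-sym e-a))
                                  (γ≢β , ≢-sym e≢β , ≢-sym e≢γ)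

      refute-t≁k : ¬ ¬ Adj H t k
      refute-t≁k ¬tk = fork (dist-□ (dist-sym (dist-two ts sk (≢-sym k≢t) ¬tk)) (dist-sym e₁-a))
                     (across (Graph.sym H sk) (dist-sym e-a))
                     (rainbow e₁ᵗ (aᵏ sk) refl α≢β (≢-sym γ≢β) (≢-sym γ≢α))

  L-rainbow-free : Connected G → ∀ {s t} → (∀ m → LRainbowFreeAt s t m) → LRainbowFree s t
  L-rainbow-free conn free e a L = dist-exists (proj₂ (conn e a)) λ (m , e-a) → free m e-a L

  L-rainbow-free-beside : Connected G → ∀ {i j u k} → Adj H i j → u ≡ i ⊎ u ≡ j → Adj H u k →
                          ¬ (k ≡ i ⊎ k ≡ j) → LRainbowFree i j × LRainbowFree j i
  L-rainbow-free-beside conn ij (inj₁ refl) ik k∉ij =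
    L-rainbow-free conn (L-rainbow-free-near ij ik (k∉ij ∘ inj₂)) ,
    L-rainbow-free conn (L-rainbow-free-far (Graph.sym H ij) ik (k∉ij ∘ inj₂))
  L-rainbow-free-beside conn ij (inj₂ refl) jk k∉ij =
    L-rainbow-free conn (L-rainbow-free-far ij jk (k∉ij ∘ inj₁)) ,
    L-rainbow-free conn (L-rainbow-free-near (Graph.sym H ij) jk (k∉ij ∘ inj₁))

  rainbow-free-at-edge : Connected G → ∀ {s t x y} → Adj H s t → Adj G x y →
                         c (x , s) ≡ c (x , t) → c (y , s) ≡ c (y , t) →
                         ∀ e → ¬ Rainbow3 c (x , s) (e , s) (y , s)
  rainbow-free-at-edge conn {s} {t} {x} {y} st xy xˢ≡xᵗ yˢ≡yᵗ e (x≢e , e≢y , x≢y) =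
    dist-exists (proj₂ (conn e x)) λ (_ , e-x) →
    dist-exists (proj₂ (conn e y)) λ (_ , e-y) → compare e-x e-y
    where
    compare : ∀ {dx dy} → Dist G e x dx → Dist G e y dy → ⊥
    compare {dx} {dy} e-x e-y with <-cmp dx dy
    ... | tri≈ _ refl _ = fork (within e-x) (within e-y) (x≢e , e≢y , x≢y)
    ... | tri< dx<dy _ _ =
      fork (across st e-x) (within (subst (Dist G e y) (≤-antisym (dist-neighbour-≤ e-x e-y xy) dx<dy) e-y))
           (rainbow (sym xˢ≡xᵗ) refl refl x≢e e≢y x≢y)
    ... | tri> _ _ dy<dx =
      fork (within (subst (Dist G e x) (≤-antisym (dist-neighbour-≤ e-y e-x (Graph.sym G xy)) dy<dx) e-x))
           (across st e-y)
           (rainbow refl refl (sym yˢ≡yᵗ) x≢e e≢y x≢y)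

  module AdjacentLayers (conn : Connected G) {P Q : W} (pq : Adj H P Q) (free-PQ : LRainbowFree P Q) (free-QP : LRainbowFree Q P) where

    rainbow-free-if-layers-differ : ∀ a → c (a , P) ≢ c (a , Q) → ∀ {u v w} →
      OnLayers P Q u → OnLayers P Q v → OnLayers P Q w → ¬ Rainbow3 c u v w
    rainbow-free-if-layers-differ a a-differs Su Sv Sw R
      with rainbow-escapes (OnLayers P Q) Su Sv Sw R (c (a , P)) (c (a , Q))
    ... | (e , _) , inj₁ refl , ≢aP , ≢aQ = free-PQ e a (≢aP , a-differs , ≢aQ)
    ... | (e , _) , inj₂ refl , ≢aP , ≢aQ = free-QP e a (≢aQ , ≢-sym a-differs , ≢aP)

    on-P : ∀ {u} → (∀ a → c (a , P) ≡ c (a , Q)) → OnLayers P Q u → c u ≡ c (proj₁ u , P)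
    on-P agree (inj₁ refl) = refl
    on-P agree (inj₂ refl) = sym (agree _)

    rainbow-free-if-layers-agree : (∀ a → c (a , P) ≡ c (a , Q)) → ∀ {u v w} →
      OnLayers P Q u → OnLayers P Q v → OnLayers P Q w → ¬ Rainbow3 c u v w
    rainbow-free-if-layers-agree agree {u} {v} Su Sv Sw R@(u≢v , _)
      with walk-exits (λ x → c (x , P) ≟ c (proj₁ u , P)) (proj₂ (conn (proj₁ u) (proj₁ v))) refl
             (λ vᴾ≡uᴾ → u≢v (trans (on-P agree Su) (trans (sym vᴾ≡uᴾ) (sym (on-P agree Sv)))))
    ... | x , y , xy , xᴾ≡uᴾ , yᴾ≢uᴾ
      with rainbow-escapes (OnLayers P Q) Su Sv Sw R (c (x , P)) (c (y , P))
    ... | e , Se , e≢x , e≢y =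
      rainbow-free-at-edge conn pq xy (agree x) (agree y) (proj₁ e)
        ((λ eq → e≢x (trans (on-P agree Se) (sym eq))) , (λ eq → e≢y (trans (on-P agree Se) eq)) ,
         λ eq → yᴾ≢uᴾ (trans (sym eq) xᴾ≡uᴾ))

module _ {n₁ : ℕ} {W : Set} (G : Graph (Fin n₁)) (H : Graph W) {r : ℕ} (c : Fin n₁ × W → Fin r)
         (no-rainbow : NoRainbow3AP (G □ H) c) (conn : Connected G) where

  open NoRainbow G H c no-rainbow

  rainbow-free-on-adjacent-layers : ∀ {P Q} → Adj H P Q → LRainbowFree P Q → LRainbowFree Q P → ∀ {u v w} →
    OnLayers P Q u → OnLayers P Q v → OnLayers P Q w → ¬ Rainbow3 c u v w
  rainbow-free-on-adjacent-layers {P} {Q} pq free-PQ free-QP with all? (λ a → c (a , P) ≟ c (a , Q))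
  ... | yes agree = rainbow-free-if-layers-agree agree
    where open AdjacentLayers conn pq free-PQ free-QP
  ... | no disagree with ¬∀⟶∃¬ n₁ _ (λ a → c (a , P) ≟ c (a , Q)) disagree
  ...   | a , a-differs = rainbow-free-if-layers-differ a a-differs
    where open AdjacentLayers conn pq free-PQ free-QP

∈-colorsOfLayers : ∀ {n₁ n₂ r} (c : Fin n₁ × Fin n₂ → Fin r) {i j κ} →
                   κ ∈ colorsOfLayers c i j → ∃[ u ] (OnLayers i j u × c u ≡ κ)
∈-colorsOfLayers c {i} {j} {κ} κ∈
  with any? (λ a → (c (a , i) ≟ κ) ⊎-dec (c (a , j) ≟ κ)) | trans (sym (lookup∘tabulate _ κ)) ([]=⇒lookup κ∈)
... | yes (a , inj₁ aⁱ≡κ) | _ = (a , i) , inj₁ refl , aⁱ≡κ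
... | yes (a , inj₂ aʲ≡κ) | _ = (a , j) , inj₂ refl , aʲ≡κ
... | no _                | ()

∃-member : ∀ {n} (p : Subset n) → 1 ≤ ∣ p ∣ → ∃[ x ] x ∈ p
∃-member (inside  ∷ p) _ = zero , here
∃-member (outside ∷ p) 1≤∣p∣ with ∃-member p 1≤∣p∣
... | x , x∈p = suc x , there x∈p

∃-two-members : ∀ {n} (p : Subset n) → 2 ≤ ∣ p ∣ → ∃[ x ] ∃[ y ] (x ∈ p × y ∈ p × x ≢ y)
∃-two-members (inside  ∷ p) (s≤s 1≤∣p∣) with ∃-member p 1≤∣p∣
... | x , x∈p = zero , suc x , here , there x∈p , λ ()
∃-two-members (outside ∷ p) 2≤∣p∣ with ∃-two-members p 2≤∣p∣
... | x , y , x∈p , y∈p , x≢y = suc x , suc y , there x∈p , there y∈p , x≢y ∘ suc-injective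

∃-three-members : ∀ {n} (p : Subset n) → 3 ≤ ∣ p ∣ →
                  ∃[ x ] ∃[ y ] ∃[ z ] (x ∈ p × y ∈ p × z ∈ p × x ≢ y × y ≢ z × x ≢ z)
∃-three-members (inside  ∷ p) (s≤s 2≤∣p∣) with ∃-two-members p 2≤∣p∣
... | y , z , y∈p , z∈p , y≢z = zero , suc y , suc z , here , there y∈p , there z∈p , (λ ()) , y≢z ∘ suc-injective , (λ ())
∃-three-members (outside ∷ p) 3≤∣p∣ with ∃-three-members p 3≤∣p∣
... | x , y , z , x∈p , y∈p , z∈p , x≢y , y≢z , x≢z =
  suc x , suc y , suc z , there x∈p , there y∈p , there z∈p ,
  x≢y ∘ suc-injective , y≢z ∘ suc-injective , x≢z ∘ suc-injective

colorsOfLayers-≤2 : ∀ {n₁ n₂ r} (c : Fin n₁ × Fin n₂ → Fin r) {i j} →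
  (∀ {u v w} → OnLayers i j u → OnLayers i j v → OnLayers i j w → ¬ Rainbow3 c u v w) →
  ∣ colorsOfLayers c i j ∣ ≤ 2
colorsOfLayers-≤2 c {i} {j} free = decidable-stable (_ ≤? 2) λ ∣p∣≰2 →
  three-colours (∃-three-members (colorsOfLayers c i j) (≰⇒> ∣p∣≰2))
  where
  three-colours : ¬ (∃[ x ] ∃[ y ] ∃[ z ] (x ∈ colorsOfLayers c i j × y ∈ colorsOfLayers c i j ×
                                           z ∈ colorsOfLayers c i j × x ≢ y × y ≢ z × x ≢ z))
  three-colours (_ , _ , _ , x∈ , y∈ , z∈ , x≢y , y≢z , x≢z)
    with ∈-colorsOfLayers c x∈ | ∈-colorsOfLayers c y∈ | ∈-colorsOfLayers c z∈
  ... | u , Su , refl | v , Sv , refl | w , Sw , refl = free Su Sv Sw (x≢y , y≢z , x≢z)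

outside-pair : ∀ {n} → 3 ≤ n → (i j : Fin n) → ∃[ k ] ¬ (k ≡ i ⊎ k ≡ j)
outside-pair (s≤s (s≤s (s≤s _))) zero          zero          = suc zero , λ { (inj₁ ()) ; (inj₂ ()) }
outside-pair (s≤s (s≤s (s≤s _))) zero          (suc zero)    = suc (suc zero) , λ { (inj₁ ()) ; (inj₂ ()) }
outside-pair (s≤s (s≤s (s≤s _))) zero          (suc (suc _)) = suc zero , λ { (inj₁ ()) ; (inj₂ ()) }
outside-pair (s≤s (s≤s (s≤s _))) (suc zero)    zero          = suc (suc zero) , λ { (inj₁ ()) ; (inj₂ ()) }
outside-pair (s≤s (s≤s (s≤s _))) (suc zero)    (suc _)       = zero , λ { (inj₁ ()) ; (inj₂ ()) }
outside-pair (s≤s (s≤s (s≤s _))) (suc (suc _)) zero          = suc zero , λ { (inj₁ ()) ; (inj₂ ()) }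
outside-pair (s≤s (s≤s (s≤s _))) (suc (suc _)) (suc _)       = zero , λ { (inj₁ ()) ; (inj₂ ()) }

edge-leaving-pair : ∀ {n} {H : Graph (Fin n)} → 3 ≤ n → Connected H → ∀ i j →
                    ∃[ u ] ∃[ k ] (Adj H u k × (u ≡ i ⊎ u ≡ j) × ¬ (k ≡ i ⊎ k ≡ j))
edge-leaving-pair 3≤n conn i j with outside-pair 3≤n i j
... | k , k∉ij = walk-exits (λ x → (x ≟ i) ⊎-dec (x ≟ j)) (proj₂ (conn i k)) (inj₁ refl) k∉ij

corollary2 : {n₁ n₂ : ℕ} (G : Graph (Fin n₁)) (H : Graph (Fin n₂)) →
    Connected G → Connected H → 2 ≤ n₁ → 3 ≤ n₂ →
    (r : ℕ) → 3 ≤ r → (c : Fin n₁ × Fin n₂ → Fin r) →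
    ExactColoring r c → NoRainbow3AP (G □ H) c →
    (i j : Fin n₂) → Adj H i j →
    ∣ colorsOfLayers c i j ∣ ≤ 2
corollary2 G H conn-G conn-H _ 3≤n₂ r _ c _ no-rainbow i j ij with edge-leaving-pair 3≤n₂ conn-H i j
... | u , k , uk , u∈ij , k∉ij with NoRainbow.L-rainbow-free-beside G H c no-rainbow conn-G ij u∈ij uk k∉ij
...   | free-ij , free-ji =
  colorsOfLayers-≤2 c (rainbow-free-on-adjacent-layers G H c no-rainbow conn-G ij free-ij free-ji)
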